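{- Let $\mathcal{G}$ be a temporal graph with VIM width $\mathsf{vim}(\mathcal{G})$, and let $\mathrm{Gf}(\mathcal{S}_{\mathsf{vim}}(\mathcal{G}))$ be the Gaifman graph of its VIM encoding. Then $\mathsf{tw}\big(\mathrm{Gf}(\mathcal{S}_{\mathsf{vim}}(\mathcal{G}))\big)\le \mathsf{vim}(\mathcal{G})+2\,\mathsf{vim}(\mathcal{G})^2$, and in particular $\mathsf{tw}\big(\mathrm{Gf}(\mathcal{S}_{\mathsf{vim}}(\mathcal{G}))\big)\in\mathcal{O}(\mathsf{vim}(\mathcal{G})^2)$.
   Context: A temporal graph $\mathcal{G}=(V,E,\lambda)$ consists of a static graph $(V,E)$ and a labelling $\lambda$ assigning each edge a nonempty finite set of time steps in $\mathbb{N}_{\ge1}$; temporal edges are pairs $(e,t)$ with $t\in\lambda(e)$, forming the set $\mathcal{E}$; the lifetime $\Lambda$ is the largest label. The activity interval of $v$ is $A(v)=[t_{\min}(v),t_{\max}(v)]$, with $t_{\min}(v),t_{\max}(v)$ the smallest and largest labels of temporal edges incident to $v$. The VIM decomposition consists of bags $\Gamma_t=\{v\in V:t\in A(v)\}$ for $t\in[\Lambda]$, and $\mathsf{vim}(\mathcal{G})=\max_t|\Gamma_t|$. The VIM encoding $\mathcal{S}_{\mathsf{vim}}(\mathcal{G})$ is the relational structure with universe $V\cup\mathcal{E}\cup\{\Gamma_t:t\in[\Lambda]\}$ (one element per bag), unary predicates for these three sorts, and binary relations: $\mathsf{inc}((uv,t),x)$ iff $x\in\{u,v\}$; $\mathsf{bag}(v,\Gamma_t)$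 iff $v\in\Gamma_t$; $\mathsf{pres}((uv,t),\Gamma_s)$ iff $s=t$ and $u,v\in\Gamma_s$; $\mathsf{next}(\Gamma_s,\Gamma_{s'})$ iff $s'=s+1$. The Gaifman graph $\mathrm{Gf}(\mathcal{S})$ of a relational structure $\mathcal{S}$ with universe $U$ is the simple undirected graph on $U$ in which distinct $a,b$ are adjacent iff they occur together in some tuple of some relation of arity at least 2. $\mathsf{tw}$ denotes treewidth. -}

module Defs where

open import Data.Nat using (ℕ; zero; suc; _+_; _*_; _≤_; _<_; _≤?_; _⊔_)
open import Data.Fin using (Fin; toℕ; _≟_) renaming (suc to fsuc)
open import Data.Fin.Properties using (any?)
open import Data.List using (List; foldr; map; length; filter; allFin)
open import Data.List.Membership.Propositional using (_∈_)
open import Data.Product using (Σ; ∃; _×_; _,_)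
open import Data.Sum using (_⊎_; inj₁; inj₂)
open import Data.Empty using (⊥)
open import Relation.Nullary using (¬_; Dec)
open import Relation.Nullary.Decidable using (_×-dec_; _⊎-dec_)
open import Relation.Binary.PropositionalEquality using (_≡_; _≢_)

-- The set 𝓔 of temporal edges is indexed by Fin m: temporal
-- edge i is ({src i, tgt i}, time i).  The static edge set E is the set
-- of pairs {src i, tgt i}; λ(e) = { time i | edge i has endpoints e },
-- which is automatically a nonempty finite set for each e ∈ E.
-- Distinct indices give distinct temporal edges (𝓔 is a set).

record TemporalGraph : Set where
  field
    n        : ℕ
    m        : ℕ
    src      : Fin m → Fin n
    tgt      : Fin m → Fin n
    time     : Fin m → ℕ
    time-pos : ∀ i → 1 ≤ time i
    loopless : ∀ i → src i ≢ tgt i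
    distinct : ∀ i j → time i ≡ time j →
               ((src i ≡ src j × tgt i ≡ tgt j) ⊎ (src i ≡ tgt j × tgt i ≡ src j)) →
               i ≡ j

module _ (G : TemporalGraph) where
  open TemporalGraph G

  -- lifetime Λ: the largest label (0 if there are no temporal edges)
  lifetime : ℕ
  lifetime = foldr _⊔_ 0 (map time (allFin m))

  Inc : Fin m → Fin n → Set
  Inc i v = src i ≡ v ⊎ tgt i ≡ v

  inc? : ∀ i v → Dec (Inc i v)
  inc? i v = (src i ≟ v) ⊎-dec (tgt i ≟ v)

  -- v ∈ Γ_t  iff  t ∈ A(v) = [t_min(v), t_max(v)], i.e. there are incident
  -- temporal edges with labels t₁ ≤ t ≤ t₂.
  InBag : Fin n → ℕ → Set
  InBag v t = ∃ λ i → ∃ λ j → (Inc i v × Inc j v) × (time i ≤ t × t ≤ time j)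

  inBag? : ∀ v t → Dec (InBag v t)
  inBag? v t = any? λ i → any? λ j →
    (inc? i v ×-dec inc? j v) ×-dec ((time i ≤? t) ×-dec (t ≤? time j))

  bagSize : ℕ → ℕ
  bagSize t = length (filter (λ v → inBag? v t) (allFin n))

  -- vim(G) = max_{t ∈ [Λ]} |Γ_t|   (bag index b : Fin Λ stands for t = b+1)
  vim : ℕ
  vim = foldr _⊔_ 0 (map (λ b → bagSize (suc (toℕ b))) (allFin lifetime))

  -- The VIM encoding S_vim(G).  Universe: V ⊎ 𝓔 ⊎ {Γ_1,…,Γ_Λ}.
  -- The bag element b : Fin Λ is Γ_{b+1}.

  Univ : Set
  Univ = Fin n ⊎ (Fin m ⊎ Fin lifetime)

  vtx : Fin n → Univ
  vtx = inj₁
  tedge : Fin m → Univ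
  tedge i = inj₂ (inj₁ i)
  bagEl : Fin lifetime → Univ
  bagEl b = inj₂ (inj₂ b)

  IsVertex IsTEdge IsBag : Univ → Set
  IsVertex x = ∃ λ v → x ≡ vtx v
  IsTEdge  x = ∃ λ i → x ≡ tedge i
  IsBag    x = ∃ λ b → x ≡ bagEl b

  incR : Univ → Univ → Set
  incR (inj₂ (inj₁ i)) (inj₁ x) = Inc i x
  incR _ _ = ⊥

  bagR : Univ → Univ → Set
  bagR (inj₁ v) (inj₂ (inj₂ b)) = InBag v (suc (toℕ b))
  bagR _ _ = ⊥

  presR : Univ → Univ → Set
  presR (inj₂ (inj₁ i)) (inj₂ (inj₂ b)) =
    time i ≡ suc (toℕ b) × InBag (src i) (suc (toℕ b)) × InBag (tgt i) (suc (toℕ b))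
  presR _ _ = ⊥

  nextR : Univ → Univ → Set
  nextR (inj₂ (inj₂ b)) (inj₂ (inj₂ b')) = toℕ b' ≡ suc (toℕ b)
  nextR _ _ = ⊥

  Cooccur : Univ → Univ → Set
  Cooccur a b = incR a b ⊎ incR b a ⊎ bagR a b ⊎ bagR b a
              ⊎ presR a b ⊎ presR b a ⊎ nextR a b ⊎ nextR b a

  GaifmanAdj : Univ → Univ → Set
  GaifmanAdj a b = a ≢ b × Cooccur a b

-- A (finite, nonempty) tree on nodes Fin (suc k) is given by a parent
-- function: node 0 is the root and node (suc i) has parent (parent i),
-- a node with smaller index.  Every finite nonempty tree arises this way
-- (number the nodes in BFS order).

record Tree : Set where
  field
    k       : ℕ
    parent  : Fin k → Fin (suc k)
    parent< : ∀ i → toℕ (parent i) < toℕ (fsuc i)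

  Node : Set
  Node = Fin (suc k)

  TAdj : Node → Node → Set
  TAdj x y = ∃ λ i → (x ≡ fsuc i × y ≡ parent i) ⊎ (y ≡ fsuc i × x ≡ parent i)

  data WalkIn (S : Node → Set) : Node → Node → Set where
    here : ∀ {x} → S x → WalkIn S x x
    step : ∀ {x y z} → S x → TAdj x y → WalkIn S y z → WalkIn S x z

  Connected : (Node → Set) → Set
  Connected S = ∀ x y → S x → S y → WalkIn S x y

-- Tree decomposition of a graph with vertex type A and adjacency Adj,
-- with all bags of size at most w + 1 (i.e. width ≤ w).
record TreeDecomposition {A : Set} (Adj : A → A → Set) (w : ℕ) : Set₁ where
  field
    tree     : Tree
  open Tree tree public
  field
    bag      : Node → List A
    bagSize≤ : ∀ x → length (bag x) ≤ suc w
    covers   : ∀ a → ∃ λ x → a ∈ bag x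
    edgeCov  : ∀ a b → Adj a b → ∃ λ x → a ∈ bag x × b ∈ bag x
    conn     : ∀ a → Connected (λ x → a ∈ bag x)

TwAtMost : {A : Set} → (A → A → Set) → ℕ → Set₁
TwAtMost Adj w = TreeDecomposition Adj w

-- Lay the VIM bags out along a path, refining the step of Γ_t into one position per temporal
-- edge: the bag at the position of a temporal edge e with label t holds Γ_t, e and the bag
-- elements Γ_t, Γ_{t+1}.  Each element of the encoding then occupies consecutive positions (a
-- vertex the steps of its activity interval, a temporal edge one position, a bag element two
-- consecutive steps) and each tuple of the encoding lies in one bag, so this is a path
-- decomposition with bags of size at most vim + 3, which is ≤ vim + 2 vim² + 1 because vim ≥ 1
-- as soon as there is a temporal edge.  Vertices meeting no temporal edge get singleton bags
-- of their own after the last step.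
module Submission where

open import Defs
open import Data.Nat using (ℕ; _+_; _*_)
open import Data.Nat as ℕ using (zero; suc; pred; _≤_; _<_; z≤n; s≤s; _/_; _%_; _⊔_; _∸_; _<?_; >-nonZero)
open import Data.Nat.Properties
open import Data.Nat.DivMod using (/-monoˡ-≤; m≡m%n+[m/n]*n; [m+kn]%n≡m%n; m<n⇒m%n≡m; m*n/n≡m; m<n*o⇒m/o<n)
open import Data.Fin using (Fin; toℕ; fromℕ<; inject₁; lower₁) renaming (zero to fzero; suc to fsuc)
open import Data.Fin.Properties using (toℕ-inject₁; toℕ-lower₁; inject₁-lower₁; toℕ-fromℕ<; toℕ-injective; toℕ<n; any?)
  renaming (0≢1+n to fzero≢fsuc; suc-injective to fsuc-injective)
open import Data.List using (List; []; _∷_; _++_; map; filter; length; tabulate; allFin; foldr)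
open import Data.List.Properties using (length-++; filter-++; filter-none; filter-some)
open import Data.List.Relation.Unary.All using (All)
open import Data.List.Relation.Unary.All.Properties using (tabulate⁺)
open import Data.List.Relation.Unary.Any using (here; there)
open import Data.List.Membership.Propositional using (_∈_; lose)
open import Data.List.Membership.Propositional.Properties using (∈-filter⁺; ∈-filter⁻; ∈-map⁺; ∈-++⁺ˡ; ∈-++⁺ʳ; ∈-allFin)
open import Data.Product using (∃; _×_; _,_; proj₂)
open import Data.Sum using (_⊎_; inj₁; inj₂)
open import Data.Empty using (⊥-elim)
open import Function using (_∘_)
open import Relation.Nullary using (¬_; yes; no)
open import Relation.Nullary.Decidable using (_×-dec_; _⊎-dec_; ¬?)
open import Relation.Unary using (Decidable)
open import Relation.Binary.PropositionalEquality using (_≡_; refl; sym; trans; cong; cong₂; subst; module ≡-Reasoning)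

module _ {A : Set} {P : A → Set} (P? : Decidable P) where

  length-filter-++ : ∀ xs ys → length (filter P? (xs ++ ys)) ≡ length (filter P? xs) + length (filter P? ys)
  length-filter-++ xs ys = trans (cong length (filter-++ P? xs ys)) (length-++ (filter P? xs))

  length-filter-map : ∀ {B : Set} (f : B → A) xs →
    length (filter P? (map f xs)) ≡ length (filter (P? ∘ f) xs)
  length-filter-map f [] = refl
  length-filter-map f (x ∷ xs) with P? (f x)
  ... | yes _ = cong suc (length-filter-map f xs)
  ... | no _  = length-filter-map f xs

  length-filter-none : ∀ {xs} → All (¬_ ∘ P) xs → length (filter P? xs) ≡ 0
  length-filter-none ¬Pxs = cong length (filter-none P? ¬Pxs)

  length-filter-tabulate≤1 : ∀ {k} (g : Fin k → A) →
    (∀ i j → P (g i) → P (g j) → i ≡ j) → length (filter P? (tabulate g)) ≤ 1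
  length-filter-tabulate≤1 {zero} g unique = z≤n
  length-filter-tabulate≤1 {suc k} g unique with P? (g fzero)
  ... | yes P₀ = s≤s (≤-reflexive (length-filter-none
                   (tabulate⁺ λ i Pi → fzero≢fsuc (unique fzero (fsuc i) P₀ Pi))))
  ... | no _   = length-filter-tabulate≤1 (g ∘ fsuc)
                   (λ i j Pi Pj → fsuc-injective (unique (fsuc i) (fsuc j) Pi Pj))

  module _ {Q : A → Set} (Q? : Decidable Q) where

    length-filter-⊆ : (∀ {x} → P x → Q x) → ∀ xs →
      length (filter P? xs) ≤ length (filter Q? xs)
    length-filter-⊆ P⊆Q [] = z≤n
    length-filter-⊆ P⊆Q (x ∷ xs) with P? x | Q? x
    ... | yes _  | yes _  = s≤s (length-filter-⊆ P⊆Q xs)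
    ... | yes Px | no ¬Qx = ⊥-elim (¬Qx (P⊆Q Px))
    ... | no _   | yes _  = m≤n⇒m≤1+n (length-filter-⊆ P⊆Q xs)
    ... | no _   | no _   = length-filter-⊆ P⊆Q xs

    length-filter-⊎ : ∀ xs → length (filter (λ x → P? x ⊎-dec Q? x) xs) ≤
                             length (filter P? xs) + length (filter Q? xs)
    length-filter-⊎ [] = z≤n
    length-filter-⊎ (x ∷ xs) with P? x | Q? x
    ... | yes _ | yes _ = s≤s (≤-trans (length-filter-⊎ xs) (+-monoʳ-≤ _ (n≤1+n _)))
    ... | yes _ | no _  = s≤s (length-filter-⊎ xs)
    ... | no _  | yes _ = ≤-trans (s≤s (length-filter-⊎ xs)) (≤-reflexive (sym (+-suc _ _)))
    ... | no _  | no _  = length-filter-⊎ xs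

∈⇒≤foldr-⊔ : ∀ {x xs} → x ∈ xs → x ≤ foldr _⊔_ 0 xs
∈⇒≤foldr-⊔ {xs = y ∷ ys} (here refl) = m≤m⊔n y _
∈⇒≤foldr-⊔ {xs = y ∷ ys} (there x∈ys) = ≤-trans (∈⇒≤foldr-⊔ x∈ys) (m≤n⊔m y _)

Convex : (ℕ → Set) → Set
Convex Q = ∀ {p q r} → p ≤ q → q ≤ r → Q p → Q r → Q q

Convex-∘-mono : ∀ {Q : ℕ → Set} {f : ℕ → ℕ} → (∀ {p q} → p ≤ q → f p ≤ f q) →
  Convex Q → Convex (Q ∘ f)
Convex-∘-mono f-mono convex p≤q q≤r = convex (f-mono p≤q) (f-mono q≤r)

≡-convex : ∀ s → Convex (_≡ s)
≡-convex s p≤q q≤r refl refl = ≤-antisym q≤r p≤q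

≡⊎suc≡-convex : ∀ s → Convex (λ t → t ≡ s ⊎ suc t ≡ s)
≡⊎suc≡-convex s {p} {q} {r} p≤q q≤r Pp Pr with m≤n⇒m<n∨m≡n (≤-trans q≤r (upper Pr))
  where
    upper : ∀ {t} → t ≡ s ⊎ suc t ≡ s → t ≤ s
    upper (inj₁ refl) = ≤-refl
    upper (inj₂ refl) = n≤1+n _
... | inj₂ q≡s = inj₁ q≡s
... | inj₁ q<s = inj₂ (≤-antisym q<s (≤-trans (lower Pp) (s≤s p≤q)))
  where
    lower : ∀ {t} → t ≡ s ⊎ suc t ≡ s → s ≤ suc t
    lower (inj₁ refl) = n≤1+n _
    lower (inj₂ refl) = ≤-refl

module _ (T : Tree) where
  open Tree T

  TAdj-sym : ∀ {x y} → TAdj x y → TAdj y x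
  TAdj-sym (i , inj₁ e) = i , inj₂ e
  TAdj-sym (i , inj₂ e) = i , inj₁ e

  WalkIn-snoc : ∀ {S x y z} → WalkIn S x y → TAdj y z → S z → WalkIn S x z
  WalkIn-snoc (here Sx) y~z Sz = step Sx y~z (here Sz)
  WalkIn-snoc (step Sx x~x′ w) y~z Sz = step Sx x~x′ (WalkIn-snoc w y~z Sz)

  WalkIn-reverse : ∀ {S x y} → WalkIn S x y → WalkIn S y x
  WalkIn-reverse (here Sx) = here Sx
  WalkIn-reverse (step Sx x~x′ w) = WalkIn-snoc (WalkIn-reverse w) (TAdj-sym x~x′) Sx

pathTree : ℕ → Tree
pathTree K = record
  { k = K ; parent = inject₁ ; parent< = λ i → s≤s (≤-reflexive (toℕ-inject₁ i)) }

module _ (K : ℕ) where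
  open Tree (pathTree K)

  pathTree-step : ∀ (x : Node) → toℕ x < K → ∃ λ y → TAdj x y × toℕ y ≡ suc (toℕ x)
  pathTree-step x x<K = fsuc i , (i , inj₂ (refl , sym (inject₁-lower₁ x K≢x))) , cong suc (toℕ-lower₁ x K≢x)
    where
      K≢x = <⇒≢ x<K ∘ sym
      i = lower₁ x K≢x

  walk-up : ∀ {Q} → Convex Q → ∀ d {x y : Node} → toℕ y ≡ d + toℕ x →
    Q (toℕ x) → Q (toℕ y) → WalkIn (Q ∘ toℕ) x y
  walk-up convex zero y≡x Qx Qy = subst (WalkIn _ _) (toℕ-injective (sym y≡x)) (here Qx)
  walk-up {Q} convex (suc d) {x} {y} y≡d+1+x Qx Qy with pathTree-step x (<-≤-trans x<y (≤-pred (toℕ<n y)))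
    where
      x<y : toℕ x < toℕ y
      x<y = ≤-trans (s≤s (m≤n+m (toℕ x) d)) (≤-reflexive (sym y≡d+1+x))
  ... | x′ , x~x′ , x′≡1+x = step Qx x~x′ (walk-up convex d y≡d+x′ Qx′ Qy)
    where
      y≡d+x′ : toℕ y ≡ d + toℕ x′
      y≡d+x′ = trans y≡d+1+x (trans (sym (+-suc d (toℕ x))) (cong (d +_) (sym x′≡1+x)))
      Qx′ : Q (toℕ x′)
      Qx′ = convex (≤-trans (n≤1+n _) (≤-reflexive (sym x′≡1+x)))
                   (≤-trans (m≤n+m _ d) (≤-reflexive (sym y≡d+x′))) Qx Qy

  pathTree-connected : ∀ {Q} → Convex Q → Connected (Q ∘ toℕ)
  pathTree-connected convex x y Qx Qy with ≤-total (toℕ x) (toℕ y)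
  ... | inj₁ x≤y = walk-up convex (toℕ y ∸ toℕ x) (sym (m∸n+n≡m x≤y)) Qx Qy
  ... | inj₂ y≤x = WalkIn-reverse (pathTree K) (walk-up convex (toℕ x ∸ toℕ y) (sym (m∸n+n≡m y≤x)) Qy Qx)

record PathDecomposition {A : Set} (Adj : A → A → Set) (w : ℕ) : Set₁ where
  field
    lastBag  : ℕ
    bag      : ℕ → List A
    bagSize≤ : ∀ p → length (bag p) ≤ suc w
    covers   : ∀ a → ∃ λ p → p ≤ lastBag × a ∈ bag p
    edgeCov  : ∀ a b → Adj a b → ∃ λ p → p ≤ lastBag × a ∈ bag p × b ∈ bag p
    convex   : ∀ a → Convex (λ p → a ∈ bag p)

pathDecomposition⇒treeDecomposition : ∀ {A : Set} {Adj : A → A → Set} {w} →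
  PathDecomposition Adj w → TreeDecomposition Adj w
pathDecomposition⇒treeDecomposition D = record
  { tree     = pathTree lastBag
  ; bag      = bag ∘ toℕ
  ; bagSize≤ = bagSize≤ ∘ toℕ
  ; covers   = λ a → atNode (λ p → a ∈ bag p) (covers a)
  ; edgeCov  = λ a b a~b → atNode (λ p → a ∈ bag p × b ∈ bag p) (edgeCov a b a~b)
  ; conn     = λ a → pathTree-connected lastBag (convex a)
  }
  where
    open PathDecomposition D
    atNode : (P : ℕ → Set) → (∃ λ p → p ≤ lastBag × P p) → ∃ λ (x : Fin (suc lastBag)) → P (toℕ x)
    atNode P (p , p≤ , Pp) = fromℕ< (s≤s p≤) , subst P (sym (toℕ-fromℕ< (s≤s p≤))) Pp

module _ (G : TemporalGraph) where
  open TemporalGraph G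

  time≤lifetime : ∀ j → time j ≤ lifetime G
  time≤lifetime j = ∈⇒≤foldr-⊔ (∈-map⁺ time (∈-allFin j))

  InBag-convex : ∀ v → Convex (InBag G v)
  InBag-convex v p≤q q≤r (i , _ , (i∋v , _) , ti≤p , _) (_ , j , (_ , j∋v) , _ , r≤tj) =
    i , j , (i∋v , j∋v) , ≤-trans ti≤p p≤q , ≤-trans q≤r r≤tj

  InBag⇒incident : ∀ {v t} → InBag G v t → ∃ λ j → Inc G j v
  InBag⇒incident (i , _ , (i∋v , _) , _) = i , i∋v

  InBag⇒≤lifetime : ∀ {v t} → InBag G v t → t ≤ lifetime G
  InBag⇒≤lifetime (_ , j , _ , _ , t≤tj) = ≤-trans t≤tj (time≤lifetime j)

  endpoint-InBag : ∀ j → InBag G (src j) (time j)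
  endpoint-InBag j = j , j , (inj₁ refl , inj₁ refl) , ≤-refl , ≤-refl

  bagSize≤vim : ∀ {t} → t < lifetime G → bagSize G (suc t) ≤ vim G
  bagSize≤vim t<Λ = subst (λ s → bagSize G (suc s) ≤ vim G) (toℕ-fromℕ< t<Λ)
    (∈⇒≤foldr-⊔ (∈-map⁺ (λ b → bagSize G (suc (toℕ b))) (∈-allFin (fromℕ< t<Λ))))

  InBag⇒vim-pos : ∀ {v t} → InBag G v t → 1 ≤ t → 1 ≤ vim G
  InBag⇒vim-pos {v} {suc t} v∈Γ _ =
    ≤-trans (filter-some (λ u → inBag? G u (suc t)) (lose (∈-allFin v) v∈Γ)) (bagSize≤vim (InBag⇒≤lifetime v∈Γ))

  lifetime-pos⇒vim-pos : 1 ≤ lifetime G → 1 ≤ vim G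
  lifetime-pos⇒vim-pos = someEdge (allFin m)
    where
      someEdge : (js : List (Fin m)) → 1 ≤ foldr _⊔_ 0 (map time js) → 1 ≤ vim G
      someEdge (j ∷ _) _ = InBag⇒vim-pos (endpoint-InBag j) (time-pos j)

module _ (M : ℕ) .{{_ : ℕ.NonZero M}} where

  [i+kM]%M≡i : ∀ {i} k → i < M → (i + k * M) % M ≡ i
  [i+kM]%M≡i {i} k i<M = trans ([m+kn]%n≡m%n i k M) (m<n⇒m%n≡m i<M)

  [i+kM]/M≡k : ∀ {i} k → i < M → (i + k * M) / M ≡ k
  [i+kM]/M≡k {i} k i<M = sym (*-cancelʳ-≡ k ((i + k * M) / M) M (+-cancelˡ-≡ i _ _ (begin
    i + k * M                              ≡⟨ m≡m%n+[m/n]*n (i + k * M) M ⟩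
    (i + k * M) % M + (i + k * M) / M * M  ≡⟨ cong (_+ (i + k * M) / M * M) ([i+kM]%M≡i k i<M) ⟩
    i + (i + k * M) / M * M                ∎)))
    where open ≡-Reasoning

  i+kM<lM : ∀ {i k l} → i < M → k < l → i + k * M < l * M
  i+kM<lM {k = k} i<M k<l = ≤-trans (+-monoˡ-< (k * M) i<M) (*-monoˡ-≤ M k<l)

module VimPathDecomposition (G : TemporalGraph) where
  open TemporalGraph G

  Λ : ℕ
  Λ = lifetime G

  -- A block of M positions stands for one time step; block t refers to Γ_{t+1}.
  M : ℕ
  M = suc m

  ΛM : ℕ
  ΛM = Λ * M

  lastPos : ℕ
  lastPos = ΛM + n

  block : ℕ → ℕ
  block p = p / M

  slot : Fin m → ℕ
  slot j = toℕ j + pred (time j) * M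

  blockStart : Fin Λ → ℕ
  blockStart b = toℕ b * M

  isolatedPos : Fin n → ℕ
  isolatedPos v = ΛM + toℕ v

  Isolated : Fin n → Set
  Isolated v = ¬ ∃ λ j → Inc G j v

  Mem : ℕ → Univ G → Set
  Mem p (inj₁ v)         = InBag G v (suc (block p)) ⊎ (Isolated v × p ≡ isolatedPos v)
  Mem p (inj₂ (inj₁ j))  = p ≡ slot j
  -- Γ_{b+1} sits in its own block and in the one before, so that consecutive bags meet.
  Mem p (inj₂ (inj₂ b))  = block p ≡ toℕ b ⊎ suc (block p) ≡ toℕ b

  mem? : ∀ p → Decidable (Mem p)
  mem? p (inj₁ v)        = inBag? G v (suc (block p)) ⊎-dec
                           (¬? (any? λ j → inc? G j v) ×-dec (p ℕ.≟ isolatedPos v))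
  mem? p (inj₂ (inj₁ j)) = p ℕ.≟ slot j
  mem? p (inj₂ (inj₂ b)) = (block p ℕ.≟ toℕ b) ⊎-dec (suc (block p) ℕ.≟ toℕ b)

  time-nonZero : ∀ j → ℕ.NonZero (time j)
  time-nonZero j = >-nonZero (time-pos j)

  slot-block : ∀ j → suc (block (slot j)) ≡ time j
  slot-block j = trans (cong suc ([i+kM]/M≡k M _ (m<n⇒m<1+n (toℕ<n j))))
                       (suc-pred (time j) {{time-nonZero j}})

  slot-active : ∀ j → slot j < ΛM
  slot-active j = i+kM<lM M (m<n⇒m<1+n (toℕ<n j))
    (subst (_≤ Λ) (sym (suc-pred (time j) {{time-nonZero j}})) (time≤lifetime G j))

  slot-injective : ∀ {i j} → slot i ≡ slot j → i ≡ j
  slot-injective {i} {j} eq = toℕ-injective (begin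
    toℕ i             ≡⟨ sym ([i+kM]%M≡i M (pred (time i)) (m<n⇒m<1+n (toℕ<n i))) ⟩
    slot i % M        ≡⟨ cong (_% M) eq ⟩
    slot j % M        ≡⟨ [i+kM]%M≡i M (pred (time j)) (m<n⇒m<1+n (toℕ<n j)) ⟩
    toℕ j             ∎)
    where open ≡-Reasoning

  blockStart-block : ∀ b → block (blockStart b) ≡ toℕ b
  blockStart-block b = m*n/n≡m (toℕ b) M

  blockStart-active : ∀ b → blockStart b < ΛM
  blockStart-active b = *-monoˡ-< M (toℕ<n b)

  Mem-convex : ∀ a → Convex (λ p → Mem p a)
  Mem-convex (inj₁ v) p≤q q≤r (inj₁ v∈Γp) (inj₁ v∈Γr) =
    inj₁ (Convex-∘-mono (λ le → s≤s (/-monoˡ-≤ M le)) (InBag-convex G v) p≤q q≤r v∈Γp v∈Γr)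
  Mem-convex (inj₁ v) _ _ (inj₁ v∈Γp) (inj₂ (isolated , _)) = ⊥-elim (isolated (InBag⇒incident G v∈Γp))
  Mem-convex (inj₁ v) _ _ (inj₂ (isolated , _)) (inj₁ v∈Γr) = ⊥-elim (isolated (InBag⇒incident G v∈Γr))
  Mem-convex (inj₁ v) p≤q q≤r (inj₂ (isolated , p≡)) (inj₂ (_ , r≡)) =
    inj₂ (isolated , ≡-convex (isolatedPos v) p≤q q≤r p≡ r≡)
  Mem-convex (inj₂ (inj₁ j)) = ≡-convex (slot j)
  Mem-convex (inj₂ (inj₂ b)) = Convex-∘-mono (/-monoˡ-≤ M) (≡⊎suc≡-convex (toℕ b))

  Meet : Univ G → Univ G → Set
  Meet a b = ∃ λ p → p < ΛM × Mem p a × Mem p b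

  Meet-sym : ∀ {a b} → Meet a b → Meet b a
  Meet-sym (p , active , Ma , Mb) = p , active , Mb , Ma

  endpoint-at-slot : ∀ {j v} → Inc G j v → Mem (slot j) (inj₁ v)
  endpoint-at-slot {j} {v} j∋v =
    inj₁ (subst (InBag G v) (sym (slot-block j)) (j , j , (j∋v , j∋v) , ≤-refl , ≤-refl))

  inc⇒Meet : ∀ a b → incR G a b → Meet a b
  inc⇒Meet (inj₁ _) _ ()
  inc⇒Meet (inj₂ (inj₂ _)) _ ()
  inc⇒Meet (inj₂ (inj₁ _)) (inj₂ _) ()
  inc⇒Meet (inj₂ (inj₁ j)) (inj₁ v) j∋v = slot j , slot-active j , refl , endpoint-at-slot j∋v

  bag⇒Meet : ∀ a b → bagR G a b → Meet a b
  bag⇒Meet (inj₂ _) _ ()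
  bag⇒Meet (inj₁ _) (inj₁ _) ()
  bag⇒Meet (inj₁ _) (inj₂ (inj₁ _)) ()
  bag⇒Meet (inj₁ v) (inj₂ (inj₂ b)) v∈Γ =
    blockStart b , blockStart-active b ,
    inj₁ (subst (λ t → InBag G v (suc t)) (sym (blockStart-block b)) v∈Γ) , inj₁ (blockStart-block b)

  pres⇒Meet : ∀ a b → presR G a b → Meet a b
  pres⇒Meet (inj₁ _) _ ()
  pres⇒Meet (inj₂ (inj₂ _)) _ ()
  pres⇒Meet (inj₂ (inj₁ _)) (inj₁ _) ()
  pres⇒Meet (inj₂ (inj₁ _)) (inj₂ (inj₁ _)) ()
  pres⇒Meet (inj₂ (inj₁ j)) (inj₂ (inj₂ b)) (time≡ , _) =
    slot j , slot-active j , refl , inj₁ (suc-injective (trans (slot-block j) time≡))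

  next⇒Meet : ∀ a b → nextR G a b → Meet a b
  next⇒Meet (inj₁ _) _ ()
  next⇒Meet (inj₂ (inj₁ _)) _ ()
  next⇒Meet (inj₂ (inj₂ _)) (inj₁ _) ()
  next⇒Meet (inj₂ (inj₂ _)) (inj₂ (inj₁ _)) ()
  next⇒Meet (inj₂ (inj₂ b)) (inj₂ (inj₂ b′)) b′≡1+b =
    blockStart b , blockStart-active b ,
    inj₁ (blockStart-block b) , inj₂ (trans (cong suc (blockStart-block b)) (sym b′≡1+b))

  Cooccur⇒Meet : ∀ a b → Cooccur G a b → Meet a b
  Cooccur⇒Meet a b (inj₁ r)                                         = inc⇒Meet a b r
  Cooccur⇒Meet a b (inj₂ (inj₁ r))                                  = Meet-sym (inc⇒Meet b a r)
  Cooccur⇒Meet a b (inj₂ (inj₂ (inj₁ r)))                           = bag⇒Meet a b r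
  Cooccur⇒Meet a b (inj₂ (inj₂ (inj₂ (inj₁ r))))                    = Meet-sym (bag⇒Meet b a r)
  Cooccur⇒Meet a b (inj₂ (inj₂ (inj₂ (inj₂ (inj₁ r)))))             = pres⇒Meet a b r
  Cooccur⇒Meet a b (inj₂ (inj₂ (inj₂ (inj₂ (inj₂ (inj₁ r))))))      = Meet-sym (pres⇒Meet b a r)
  Cooccur⇒Meet a b (inj₂ (inj₂ (inj₂ (inj₂ (inj₂ (inj₂ (inj₁ r))))))) = next⇒Meet a b r
  Cooccur⇒Meet a b (inj₂ (inj₂ (inj₂ (inj₂ (inj₂ (inj₂ (inj₂ r))))))) = Meet-sym (next⇒Meet b a r)

  active≤lastPos : ∀ {p} → p < ΛM → p ≤ lastPos
  active≤lastPos p<ΛM = ≤-trans (<⇒≤ p<ΛM) (m≤m+n ΛM n)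

  Mem-somewhere : ∀ a → ∃ λ p → p ≤ lastPos × Mem p a
  Mem-somewhere (inj₁ v) with any? (λ j → inc? G j v)
  ... | yes (j , j∋v) = slot j , active≤lastPos (slot-active j) , endpoint-at-slot j∋v
  ... | no isolated   = isolatedPos v , +-monoʳ-≤ ΛM (<⇒≤ (toℕ<n v)) , inj₂ (isolated , refl)
  Mem-somewhere (inj₂ (inj₁ j)) = slot j , active≤lastPos (slot-active j) , refl
  Mem-somewhere (inj₂ (inj₂ b)) = blockStart b , active≤lastPos (blockStart-active b) , inj₁ (blockStart-block b)

  universe : List (Univ G)
  universe = map (vtx G) (allFin n) ++ map (tedge G) (allFin m) ++ map (bagEl G) (allFin Λ)

  ∈-universe : ∀ a → a ∈ universe
  ∈-universe (inj₁ v)        = ∈-++⁺ˡ (∈-map⁺ (vtx G) (∈-allFin v))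
  ∈-universe (inj₂ (inj₁ j)) = ∈-++⁺ʳ (map (vtx G) (allFin n)) (∈-++⁺ˡ (∈-map⁺ (tedge G) (∈-allFin j)))
  ∈-universe (inj₂ (inj₂ b)) = ∈-++⁺ʳ (map (vtx G) (allFin n))
                                 (∈-++⁺ʳ (map (tedge G) (allFin m)) (∈-map⁺ (bagEl G) (∈-allFin b)))

  bag : ℕ → List (Univ G)
  bag p = filter (mem? p) universe

  Mem⇒∈bag : ∀ {p a} → Mem p a → a ∈ bag p
  Mem⇒∈bag {p} {a} = ∈-filter⁺ (mem? p) (∈-universe a)

  ∈bag⇒Mem : ∀ {p a} → a ∈ bag p → Mem p a
  ∈bag⇒Mem {p} = proj₂ ∘ ∈-filter⁻ (mem? p) {xs = universe}

  #vertices #edges #bags : ℕ → ℕ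
  #vertices p = length (filter (mem? p ∘ vtx G) (allFin n))
  #edges    p = length (filter (mem? p ∘ tedge G) (allFin m))
  #bags     p = length (filter (mem? p ∘ bagEl G) (allFin Λ))

  length-bag : ∀ p → length (bag p) ≡ #vertices p + (#edges p + #bags p)
  length-bag p = begin
    length (filter (mem? p) (Vs ++ Es ++ Bs))
      ≡⟨ length-filter-++ (mem? p) Vs (Es ++ Bs) ⟩
    length (filter (mem? p) Vs) + length (filter (mem? p) (Es ++ Bs))
      ≡⟨ cong (length (filter (mem? p) Vs) +_) (length-filter-++ (mem? p) Es Bs) ⟩
    length (filter (mem? p) Vs) + (length (filter (mem? p) Es) + length (filter (mem? p) Bs))
      ≡⟨ cong₂ _+_ (length-filter-map (mem? p) (vtx G) (allFin n))
                   (cong₂ _+_ (length-filter-map (mem? p) (tedge G) (allFin m))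
                              (length-filter-map (mem? p) (bagEl G) (allFin Λ))) ⟩
    #vertices p + (#edges p + #bags p) ∎
    where
      open ≡-Reasoning
      Vs = map (vtx G) (allFin n)
      Es = map (tedge G) (allFin m)
      Bs = map (bagEl G) (allFin Λ)

  #edges≤1 : ∀ p → #edges p ≤ 1
  #edges≤1 p = length-filter-tabulate≤1 (mem? p ∘ tedge G) (λ j → j)
    (λ i j p≡i p≡j → slot-injective (trans (sym p≡i) p≡j))

  #bags≤2 : ∀ p → #bags p ≤ 2
  #bags≤2 p = ≤-trans (length-filter-⊎ current? next? (allFin Λ))
    (+-mono-≤ (length-filter-tabulate≤1 current? (λ b → b) (λ b b′ e e′ → toℕ-injective (trans (sym e) e′)))
              (length-filter-tabulate≤1 next? (λ b → b) (λ b b′ e e′ → toℕ-injective (trans (sym e) e′))))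
    where
      current? : Decidable (λ (b : Fin Λ) → block p ≡ toℕ b)
      current? b = block p ℕ.≟ toℕ b
      next? : Decidable (λ (b : Fin Λ) → suc (block p) ≡ toℕ b)
      next? b = suc (block p) ℕ.≟ toℕ b

  active-bagSize : ∀ {p} → p < ΛM → length (bag p) ≤ suc (vim G + 2 * (vim G * vim G))
  active-bagSize {p} p<ΛM = begin
    length (bag p)                        ≡⟨ length-bag p ⟩
    #vertices p + (#edges p + #bags p)    ≤⟨ +-mono-≤ #vertices≤vim (+-mono-≤ (#edges≤1 p) (#bags≤2 p)) ⟩
    vim G + 3                             ≡⟨ +-suc (vim G) 2 ⟩
    suc (vim G + 2 * 1)                   ≤⟨ s≤s (+-monoʳ-≤ (vim G) (*-monoʳ-≤ 2 (*-mono-≤ 1≤vim 1≤vim))) ⟩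
    suc (vim G + 2 * (vim G * vim G))     ∎
    where
      open ≤-Reasoning
      block<Λ : block p < Λ
      block<Λ = m<n*o⇒m/o<n p<ΛM
      1≤vim : 1 ≤ vim G
      1≤vim = lifetime-pos⇒vim-pos G (≤-<-trans z≤n block<Λ)
      onlyInBag : ∀ {v} → Mem p (inj₁ v) → InBag G v (suc (block p))
      onlyInBag (inj₁ v∈Γ) = v∈Γ
      onlyInBag (inj₂ (_ , p≡)) = ⊥-elim (<⇒≱ p<ΛM (≤-trans (m≤m+n ΛM _) (≤-reflexive (sym p≡))))
      #vertices≤vim : #vertices p ≤ vim G
      #vertices≤vim = ≤-trans (length-filter-⊆ (mem? p ∘ vtx G) (λ v → inBag? G v (suc (block p))) onlyInBag (allFin n))
                              (bagSize≤vim G block<Λ)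

  tail-bagSize : ∀ {p} → ΛM ≤ p → length (bag p) ≤ 1
  tail-bagSize {p} ΛM≤p = begin
    length (bag p)                        ≡⟨ length-bag p ⟩
    #vertices p + (#edges p + #bags p)    ≡⟨ cong (#vertices p +_) (cong₂ _+_ #edges≡0 #bags≡0) ⟩
    #vertices p + 0                       ≤⟨ +-monoˡ-≤ 0 #vertices≤1 ⟩
    1                                     ∎
    where
      open ≤-Reasoning
      Λ≤block : Λ ≤ block p
      Λ≤block = subst (_≤ block p) (m*n/n≡m Λ M) (/-monoˡ-≤ M ΛM≤p)
      isolatedAt : ∀ {v} → Mem p (inj₁ v) → p ≡ isolatedPos v
      isolatedAt (inj₁ v∈Γ) = ⊥-elim (<⇒≱ (InBag⇒≤lifetime G v∈Γ) Λ≤block)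
      isolatedAt (inj₂ (_ , p≡)) = p≡
      #vertices≤1 : #vertices p ≤ 1
      #vertices≤1 = length-filter-tabulate≤1 (mem? p ∘ vtx G) (λ v → v) λ u v Mu Mv →
        toℕ-injective (+-cancelˡ-≡ ΛM _ _ (trans (sym (isolatedAt Mu)) (isolatedAt Mv)))
      #edges≡0 : #edges p ≡ 0
      #edges≡0 = length-filter-none (mem? p ∘ tedge G)
        (tabulate⁺ λ j p≡slot → <⇒≱ (slot-active j) (≤-trans ΛM≤p (≤-reflexive p≡slot)))
      block≤ : ∀ {b} → Mem p (inj₂ (inj₂ b)) → block p ≤ toℕ b
      block≤ (inj₁ e) = ≤-reflexive e
      block≤ (inj₂ e) = ≤-trans (n≤1+n _) (≤-reflexive e)
      #bags≡0 : #bags p ≡ 0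
      #bags≡0 = length-filter-none (mem? p ∘ bagEl G)
        (tabulate⁺ λ b Mb → <⇒≱ (toℕ<n b) (≤-trans Λ≤block (block≤ Mb)))

  bagSize≤ : ∀ p → length (bag p) ≤ suc (vim G + 2 * (vim G * vim G))
  bagSize≤ p with p <? ΛM
  ... | yes p<ΛM = active-bagSize p<ΛM
  ... | no p≮ΛM  = ≤-trans (tail-bagSize (≮⇒≥ p≮ΛM)) (s≤s z≤n)

  vimPathDecomposition : PathDecomposition (GaifmanAdj G) (vim G + 2 * (vim G * vim G))
  vimPathDecomposition = record
    { lastBag  = lastPos
    ; bag      = bag
    ; bagSize≤ = bagSize≤
    ; covers   = λ a → let (p , p≤ , Mp) = Mem-somewhere a in p , p≤ , Mem⇒∈bag Mp
    ; edgeCov  = λ a b (_ , a~b) → let (p , p<ΛM , Ma , Mb) = Cooccur⇒Meet a b a~b in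
                   p , active≤lastPos p<ΛM , Mem⇒∈bag Ma , Mem⇒∈bag Mb
    ; convex   = λ a p≤q q≤r a∈p a∈r → Mem⇒∈bag (Mem-convex a p≤q q≤r (∈bag⇒Mem a∈p) (∈bag⇒Mem a∈r))
    }

mainTheorem3 : (G : TemporalGraph) →
    TwAtMost (GaifmanAdj G) (vim G + 2 * (vim G * vim G))
mainTheorem3 G = pathDecomposition⇒treeDecomposition (VimPathDecomposition.vimPathDecomposition G)
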